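{- Let $R$ be a p.q.-Baer $*$-ring with at least four central projections. Then the complement $\Gamma^*_s(R)^c$ of the strong zero-divisor graph of $R$ is connected if and only if $R$ has at least six central projections, i.e. $|CP(R)|\geq 6$.
   Context: A $*$-ring is a ring $R$ with an involution $x\mapsto x^*$. A projection is an element $e$ with $e^2=e=e^*$; a central projection is a projection in the centre of $R$; $CP(R)$ denotes the set of central projections of $R$. For $S\subseteq R$, $r_R(S)=\{x\in R: sx=0\ \forall s\in S\}$. $R$ is a p.q.-Baer $*$-ring if for every $a\in R$, $r_R(aR)=eR$ for some projection $e\in R$. The strong zero-divisor graph $\Gamma^*_s(R)$ is the simple undirected graph with vertex set $\{0\neq a\in R: r_R(aR)\neq\{0\}\}$, in which distinct vertices $a,b$ are adjacent iff $aRb^*=0$. The complement $G^c$ of a simple graph $G$ has the same vertices, with distinct vertices adjacent iff they are not adjacent in $G$. -}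

module Defs where

open import Level using (Level; _⊔_; suc)
open import Algebra.Bundles using (Ring)
open import Data.Fin using (Fin)
open import Data.Product using (Σ; ∃; _×_; _,_; proj₁)
open import Relation.Binary.PropositionalEquality using (_≡_)
open import Relation.Nullary using (¬_)
open import Function.Bundles using (_⇔_)

record StarRing (c ℓ : Level) : Set (suc (c ⊔ ℓ)) where
  field
    ring : Ring c ℓ
  open Ring ring public
  field
    _⋆         : Carrier → Carrier
    ⋆-cong     : ∀ {x y} → x ≈ y → x ⋆ ≈ y ⋆
    ⋆-involutive : ∀ x → (x ⋆) ⋆ ≈ x
    ⋆-+        : ∀ x y → (x + y) ⋆ ≈ (x ⋆) + (y ⋆)
    ⋆-*        : ∀ x y → (x * y) ⋆ ≈ (y ⋆) * (x ⋆)

module _ {c ℓ : Level} (R : StarRing c ℓ) where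
  open StarRing R

  IsProjection : Carrier → Set ℓ
  IsProjection e = (e * e ≈ e) × (e ⋆ ≈ e)

  IsCentral : Carrier → Set (c ⊔ ℓ)
  IsCentral e = ∀ x → e * x ≈ x * e

  IsCentralProjection : Carrier → Set (c ⊔ ℓ)
  IsCentralProjection e = IsProjection e × IsCentral e

  InRightAnnOfaR : Carrier → Carrier → Set (c ⊔ ℓ)
  InRightAnnOfaR a x = ∀ r → (a * r) * x ≈ 0#

  InPrincipalRight : Carrier → Carrier → Set (c ⊔ ℓ)
  InPrincipalRight e x = ∃ λ y → x ≈ e * y

  IsPQBaer : Set (c ⊔ ℓ)
  IsPQBaer = ∀ a → ∃ λ e → IsProjection e ×
               (∀ x → InRightAnnOfaR a x ⇔ InPrincipalRight e x)

  AtLeastCP : (k : _) → Set (c ⊔ ℓ)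
  AtLeastCP k = Σ (Fin k → Carrier) λ f →
                  (∀ i → IsCentralProjection (f i)) ×
                  (∀ i j → f i ≈ f j → i ≡ j)

  IsVertex : Carrier → Set (c ⊔ ℓ)
  IsVertex a = (¬ (a ≈ 0#)) × (∃ λ x → (¬ (x ≈ 0#)) × InRightAnnOfaR a x)

  Vertex : Set (c ⊔ ℓ)
  Vertex = Σ Carrier IsVertex

  -- adjacency in Γ*_s(R): a R b* = 0 (for distinct a, b)
  AdjΓ : Carrier → Carrier → Set (c ⊔ ℓ)
  AdjΓ a b = ∀ r → (a * r) * (b ⋆) ≈ 0#

  AdjComplement : Vertex → Vertex → Set (c ⊔ ℓ)
  AdjComplement u v = (¬ (proj₁ u ≈ proj₁ v)) × (¬ AdjΓ (proj₁ u) (proj₁ v))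

  data WalkComplement : Vertex → Vertex → Set (c ⊔ ℓ) where
    stop : ∀ {u v} → proj₁ u ≈ proj₁ v → WalkComplement u v
    step : ∀ {u w v} → AdjComplement u w → WalkComplement w v → WalkComplement u v

  ComplementConnected : Set (c ⊔ ℓ)
  ComplementConnected = ∀ u v → WalkComplement u v

{-# OPTIONS --safe #-}
-- In a p.q.-Baer *-ring the projection f generating r(aR) is central, so s(a) = 1 - f is a
-- central projection with a s(a) = a that kills r(aR). Hence Γ-adjacent a, b have orthogonal
-- supports, and a central projection h ≠ 1 with h s(a) ≠ 0 ≠ h s(b) is Γ-adjacent to neither.
-- If |CP(R)| ≥ 6 such an h always exists: s(a) + s(b) unless that is 1, and otherwise some
-- z ∉ {0, 1, s(a), s(b)} or its complement; so a — h — b is a path in the complement.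
-- Conversely, take e ∈ CP(R) \ {0, 1}. Since e is Γ-adjacent to 1 - e, a complement path from
-- e to 1 - e has an edge u — w with u but not w Γ-adjacent to 1 - e. Then q = s(w) ≠ 1 meets
-- both e and 1 - e, so qe, q(1 - e) and 1 - q are three orthogonal nonzero central
-- projections, and their 2³ partial sums are distinct.
module Submission where

open import Defs
open import Level using (_⊔_; Lift; lift; lower)
open import Axiom.ExcludedMiddle using (ExcludedMiddle)
open import Function.Bundles using (_⇔_; mk⇔; Equivalence)
open import Data.Bool using (Bool; true; false; if_then_else_)
open import Data.Fin using (Fin; inject≤)
open import Data.Fin.Patterns using (0F; 1F; 2F; 3F; 4F; 5F; 6F; 7F)
open import Data.Fin.Properties using (pigeonhole; <⇒≢; inject≤-injective)
open import Data.Nat using (_≤_; _<_; z<s; s<s)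
open import Data.Nat.Properties using (m≤m+n)
open import Data.Product using (Σ; ∃; ∃₂; _×_; _,_; proj₁; proj₂)
open import Data.Vec.Functional using ([]; _∷_)
open import Relation.Nullary using (¬_; Dec; yes; no; contradiction)
open import Relation.Nullary.Decidable using (map′)
import Relation.Binary.PropositionalEquality as ≡
open ≡ using (_≡_)
import Algebra.Properties.Ring as RingProperties
import Algebra.Properties.Group as GroupProperties

bits : Fin 8 → Bool × Bool × Bool
bits 0F = false , false , false
bits 1F = false , false , true
bits 2F = false , true  , false
bits 3F = false , true  , true
bits 4F = true  , false , false
bits 5F = true  , false , true
bits 6F = true  , true  , false
bits 7F = true  , true  , true

index : Bool × Bool × Bool → Fin 8
index (false , false , false) = 0F
index (false , false , true ) = 1F
index (false , true  , false) = 2F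
index (false , true  , true ) = 3F
index (true  , false , false) = 4F
index (true  , false , true ) = 5F
index (true  , true  , false) = 6F
index (true  , true  , true ) = 7F

index-bits : ∀ i → index (bits i) ≡ i
index-bits 0F = ≡.refl
index-bits 1F = ≡.refl
index-bits 2F = ≡.refl
index-bits 3F = ≡.refl
index-bits 4F = ≡.refl
index-bits 5F = ≡.refl
index-bits 6F = ≡.refl
index-bits 7F = ≡.refl

bits-injective : ∀ {i j} → bits i ≡ bits j → i ≡ j
bits-injective {i} {j} eq =
  ≡.trans (≡.sym (index-bits i)) (≡.trans (≡.cong index eq) (index-bits j))

module _ {c ℓ} (R : StarRing c ℓ) where
  open StarRing R hiding (zero)
  open RingProperties ring using (x+x≈x⇒x≈0; x[y-z]≈xy-xz; [y-z]x≈yx-zx)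
  open GroupProperties +-group
    using (inverseʳ-unique; identityʳ-unique; x∙y⁻¹≈ε⇒x≈y; x≈y⇒x∙y⁻¹≈ε; ε⁻¹≈ε; ⁻¹-injective)
  open import Relation.Binary.Reasoning.Setoid setoid hiding (stop)

  ⋆-zero : 0# ⋆ ≈ 0#
  ⋆-zero = x+x≈x⇒x≈0 (0# ⋆) (begin
    0# ⋆ + 0# ⋆  ≈⟨ ⋆-+ 0# 0# ⟨
    (0# + 0#) ⋆  ≈⟨ ⋆-cong (+-identityʳ 0#) ⟩
    0# ⋆         ∎)

  ⋆-one : 1# ⋆ ≈ 1#
  ⋆-one = begin
    1# ⋆           ≈⟨ *-identityʳ (1# ⋆) ⟨
    1# ⋆ * 1#      ≈⟨ *-cong refl (⋆-involutive 1#) ⟨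
    1# ⋆ * 1# ⋆ ⋆  ≈⟨ ⋆-* (1# ⋆) 1# ⟨
    (1# ⋆ * 1#) ⋆  ≈⟨ ⋆-cong (*-identityʳ (1# ⋆)) ⟩
    1# ⋆ ⋆         ≈⟨ ⋆-involutive 1# ⟩
    1#             ∎

  ⋆-neg : ∀ x → (- x) ⋆ ≈ - (x ⋆)
  ⋆-neg x = inverseʳ-unique (x ⋆) ((- x) ⋆) (begin
    x ⋆ + (- x) ⋆  ≈⟨ ⋆-+ x (- x) ⟨
    (x - x) ⋆      ≈⟨ ⋆-cong (-‿inverseʳ x) ⟩
    0# ⋆           ≈⟨ ⋆-zero ⟩
    0#             ∎)

  ⋆-*-selfAdjointˡ : ∀ {u} → u ⋆ ≈ u → ∀ x → (u * x) ⋆ ≈ x ⋆ * u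
  ⋆-*-selfAdjointˡ u⋆≈u x = trans (⋆-* _ x) (*-cong refl u⋆≈u)

  ⋆-*-selfAdjointʳ : ∀ {u} → u ⋆ ≈ u → ∀ x → (x * u) ⋆ ≈ u * x ⋆
  ⋆-*-selfAdjointʳ u⋆≈u x = trans (⋆-* x _) (*-cong u⋆≈u refl)

  x-0≈x : ∀ x → x - 0# ≈ x
  x-0≈x x = trans (+-cong refl ε⁻¹≈ε) (+-identityʳ x)

  infix 20 _ᶜ
  _ᶜ : Carrier → Carrier
  x ᶜ = 1# - x

  ᶜ-*ˡ : ∀ x y → x ᶜ * y ≈ y - x * y
  ᶜ-*ˡ x y = trans ([y-z]x≈yx-zx y 1# x) (+-cong (*-identityˡ y) refl)

  ᶜ-*ʳ : ∀ x y → y * x ᶜ ≈ y - y * x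
  ᶜ-*ʳ x y = trans (x[y-z]≈xy-xz y 1# x) (+-cong (*-identityʳ y) refl)

  idem⇒*ᶜ≈0 : ∀ {x} → x * x ≈ x → x * x ᶜ ≈ 0#
  idem⇒*ᶜ≈0 {x} x²≈x = trans (ᶜ-*ʳ x x) (x≈y⇒x∙y⁻¹≈ε (sym x²≈x))

  *-split : ∀ x y → x * y + x * y ᶜ ≈ x
  *-split x y = begin
    x * y + x * y ᶜ       ≈⟨ distribˡ x y (y ᶜ) ⟨
    x * (y + y ᶜ)         ≈⟨ *-cong refl (+-cong refl (+-comm 1# (- y))) ⟩
    x * (y + (- y + 1#))  ≈⟨ *-cong refl (+-assoc y (- y) 1#) ⟨
    x * ((y - y) + 1#)    ≈⟨ *-cong refl (+-cong (-‿inverseʳ y) refl) ⟩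
    x * (0# + 1#)         ≈⟨ *-cong refl (+-identityˡ 1#) ⟩
    x * 1#                ≈⟨ *-identityʳ x ⟩
    x                     ∎

  ᶜ≈0⇒≈1 : ∀ {x} → x ᶜ ≈ 0# → x ≈ 1#
  ᶜ≈0⇒≈1 {x} xᶜ≈0 = sym (x∙y⁻¹≈ε⇒x≈y 1# x xᶜ≈0)

  ᶜ≈1⇒≈0 : ∀ {x} → x ᶜ ≈ 1# → x ≈ 0#
  ᶜ≈1⇒≈0 {x} xᶜ≈1 = ⁻¹-injective (trans (identityʳ-unique 1# (- x) xᶜ≈1) (sym ε⁻¹≈ε))

  CP : Carrier → Set (c ⊔ ℓ)
  CP = IsCentralProjection R

  CP-idem : ∀ {e} → CP e → e * e ≈ e
  CP-idem ((e²≈e , _) , _) = e²≈e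

  CP-⋆ : ∀ {e} → CP e → e ⋆ ≈ e
  CP-⋆ ((_ , e⋆≈e) , _) = e⋆≈e

  CP-central : ∀ {e} → CP e → IsCentral R e
  CP-central (_ , central) = central

  CP-*ᶜ : ∀ {e} → CP e → e * e ᶜ ≈ 0#
  CP-*ᶜ ce = idem⇒*ᶜ≈0 (CP-idem ce)

  CP-orthogonal-sym : ∀ {e f} → CP e → e * f ≈ 0# → f * e ≈ 0#
  CP-orthogonal-sym {e} {f} ce ef≈0 = trans (sym (CP-central ce f)) ef≈0

  CP-0 : CP 0#
  CP-0 = (zeroˡ 0# , ⋆-zero) , λ y → trans (zeroˡ y) (sym (zeroʳ y))

  CP-ᶜ : ∀ {e} → CP e → CP (e ᶜ)
  CP-ᶜ {e} ce = (idem , selfAdjoint) , central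
    where
    idem : e ᶜ * e ᶜ ≈ e ᶜ
    idem = begin
      e ᶜ * e ᶜ        ≈⟨ ᶜ-*ˡ e (e ᶜ) ⟩
      e ᶜ - e * e ᶜ    ≈⟨ +-cong refl (-‿cong (CP-*ᶜ ce)) ⟩
      e ᶜ - 0#         ≈⟨ x-0≈x (e ᶜ) ⟩
      e ᶜ              ∎
    selfAdjoint : e ᶜ ⋆ ≈ e ᶜ
    selfAdjoint = begin
      (1# - e) ⋆       ≈⟨ ⋆-+ 1# (- e) ⟩
      1# ⋆ + (- e) ⋆   ≈⟨ +-cong ⋆-one (⋆-neg e) ⟩
      1# - e ⋆         ≈⟨ +-cong refl (-‿cong (CP-⋆ ce)) ⟩
      1# - e           ∎
    central : IsCentral R (e ᶜ)
    central y = begin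
      e ᶜ * y          ≈⟨ ᶜ-*ˡ e y ⟩
      y - e * y        ≈⟨ +-cong refl (-‿cong (CP-central ce y)) ⟩
      y - y * e        ≈⟨ ᶜ-*ʳ e y ⟨
      y * e ᶜ          ∎

  CP-* : ∀ {e f} → CP e → CP f → CP (e * f)
  CP-* {e} {f} ce cf = (idem , selfAdjoint) , central
    where
    idem : (e * f) * (e * f) ≈ e * f
    idem = begin
      (e * f) * (e * f)  ≈⟨ *-assoc e f (e * f) ⟩
      e * (f * (e * f))  ≈⟨ *-cong refl (CP-central cf (e * f)) ⟩
      e * ((e * f) * f)  ≈⟨ *-cong refl (*-assoc e f f) ⟩
      e * (e * (f * f))  ≈⟨ *-assoc e e (f * f) ⟨
      (e * e) * (f * f)  ≈⟨ *-cong (CP-idem ce) (CP-idem cf) ⟩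
      e * f              ∎
    selfAdjoint : (e * f) ⋆ ≈ e * f
    selfAdjoint = trans (⋆-*-selfAdjointʳ (CP-⋆ cf) e) (trans (*-cong refl (CP-⋆ ce)) (CP-central cf e))
    central : IsCentral R (e * f)
    central y = begin
      (e * f) * y  ≈⟨ *-assoc e f y ⟩
      e * (f * y)  ≈⟨ *-cong refl (CP-central cf y) ⟩
      e * (y * f)  ≈⟨ *-assoc e y f ⟨
      (e * y) * f  ≈⟨ *-cong (CP-central ce y) refl ⟩
      (y * e) * f  ≈⟨ *-assoc y e f ⟩
      y * (e * f)  ∎

  CP-+ : ∀ {e f} → CP e → CP f → e * f ≈ 0# → CP (e + f)
  CP-+ {e} {f} ce cf ef≈0 = (idem , selfAdjoint) , central
    where
    idem : (e + f) * (e + f) ≈ e + f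
    idem = begin
      (e + f) * (e + f)                  ≈⟨ distribˡ (e + f) e f ⟩
      (e + f) * e + (e + f) * f          ≈⟨ +-cong (distribʳ e e f) (distribʳ f e f) ⟩
      (e * e + f * e) + (e * f + f * f)  ≈⟨ +-cong (+-cong (CP-idem ce) (CP-orthogonal-sym ce ef≈0))
                                                   (+-cong ef≈0 (CP-idem cf)) ⟩
      (e + 0#) + (0# + f)                ≈⟨ +-cong (+-identityʳ e) (+-identityˡ f) ⟩
      e + f                              ∎
    selfAdjoint : (e + f) ⋆ ≈ e + f
    selfAdjoint = trans (⋆-+ e f) (+-cong (CP-⋆ ce) (CP-⋆ cf))
    central : IsCentral R (e + f)
    central y = begin
      (e + f) * y    ≈⟨ distribʳ y e f ⟩
      e * y + f * y  ≈⟨ +-cong (CP-central ce y) (CP-central cf y) ⟩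
      y * e + y * f  ≈⟨ distribˡ y e f ⟨
      y * (e + f)    ∎

  MeetsBoth : Carrier → Carrier → Carrier → Set (c ⊔ ℓ)
  MeetsBoth p q h = CP h × ¬ h ≈ 1# × ¬ h * p ≈ 0# × ¬ h * q ≈ 0#

  MeetsBoth-swap : ∀ {p q h} → MeetsBoth p q h → MeetsBoth q p h
  MeetsBoth-swap (ch , h≉1 , hp≉0 , hq≉0) = ch , h≉1 , hq≉0 , hp≉0

  complement-meets-both : ∀ {p q z} → CP z → ¬ z ≈ 0# → ¬ z ≈ q → ¬ p ≈ 0# →
    p + q ≈ 1# → z * p ≈ 0# → MeetsBoth p q (z ᶜ)
  complement-meets-both {p} {q} {z} cz z≉0 z≉q p≉0 p+q≈1 zp≈0 =
    CP-ᶜ cz , (λ zᶜ≈1 → z≉0 (ᶜ≈1⇒≈0 zᶜ≈1)) , (λ zᶜp≈0 → p≉0 (trans (sym zᶜp≈p) zᶜp≈0)) ,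
    λ zᶜq≈0 → z≉q (sym (x∙y⁻¹≈ε⇒x≈y q z (trans (sym zᶜq≈q-z) zᶜq≈0)))
    where
    zq≈z : z * q ≈ z
    zq≈z = begin
      z * q          ≈⟨ +-identityˡ (z * q) ⟨
      0# + z * q     ≈⟨ +-cong zp≈0 refl ⟨
      z * p + z * q  ≈⟨ distribˡ z p q ⟨
      z * (p + q)    ≈⟨ *-cong refl p+q≈1 ⟩
      z * 1#         ≈⟨ *-identityʳ z ⟩
      z              ∎
    zᶜp≈p : z ᶜ * p ≈ p
    zᶜp≈p = trans (ᶜ-*ˡ z p) (trans (+-cong refl (-‿cong zp≈0)) (x-0≈x p))
    zᶜq≈q-z : z ᶜ * q ≈ q - z
    zᶜq≈q-z = trans (ᶜ-*ˡ z q) (+-cong refl (-‿cong zq≈z))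

  *-interchange : ∀ {t} → IsCentral R t → ∀ s s′ t′ → (s * t) * (s′ * t′) ≈ (s * s′) * (t * t′)
  *-interchange {t} central s s′ t′ = begin
    (s * t) * (s′ * t′)  ≈⟨ *-assoc s t (s′ * t′) ⟩
    s * (t * (s′ * t′))  ≈⟨ *-cong refl (*-assoc t s′ t′) ⟨
    s * ((t * s′) * t′)  ≈⟨ *-cong refl (*-cong (central s′) refl) ⟩
    s * ((s′ * t) * t′)  ≈⟨ *-cong refl (*-assoc s′ t t′) ⟩
    s * (s′ * (t * t′))  ≈⟨ *-assoc s s′ (t * t′) ⟨
    (s * s′) * (t * t′)  ∎

  *-orthogonal-*ˡ : ∀ {s s′ t} → IsCentral R t → s * s′ ≈ 0# → (s * t) * s′ ≈ 0#
  *-orthogonal-*ˡ {s} {s′} {t} central ss′≈0 = begin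
    (s * t) * s′  ≈⟨ *-cong (central s) refl ⟨
    (t * s) * s′  ≈⟨ *-assoc t s s′ ⟩
    t * (s * s′)  ≈⟨ *-cong refl ss′≈0 ⟩
    t * 0#        ≈⟨ zeroʳ t ⟩
    0#            ∎

  *-orthogonalʳ : ∀ {t t′} → IsCentral R t → t * t′ ≈ 0# → ∀ s s′ → (s * t) * (s′ * t′) ≈ 0#
  *-orthogonalʳ central tt′≈0 s s′ =
    trans (*-interchange central s s′ _) (trans (*-cong refl tt′≈0) (zeroʳ _))

  when : Bool → Carrier → Carrier
  when b u = if b then u else 0#

  when-CP : ∀ b {u} → CP u → CP (when b u)
  when-CP true  cu = cu
  when-CP false _  = CP-0

  when-orthogonal : ∀ a b {u v} → u * v ≈ 0# → when a u * when b v ≈ 0#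
  when-orthogonal true  true  uv≈0 = uv≈0
  when-orthogonal true  false _    = zeroʳ _
  when-orthogonal false _     _    = zeroˡ _

  when-idem : ∀ b {u} → u * u ≈ u → when b u * u ≈ when b u
  when-idem true  u²≈u = u²≈u
  when-idem false _    = zeroˡ _

  when-injective : ∀ {a b u} → ¬ u ≈ 0# → when a u ≈ when b u → a ≡ b
  when-injective {true}  {true}  _   _  = ≡.refl
  when-injective {true}  {false} u≉0 eq = contradiction eq u≉0
  when-injective {false} {true}  u≉0 eq = contradiction (sym eq) u≉0
  when-injective {false} {false} _   _  = ≡.refl

  module OrthogonalSums {x y z} (cx : CP x) (cy : CP y) (cz : CP z)
                        (xy≈0 : x * y ≈ 0#) (xz≈0 : x * z ≈ 0#) (yz≈0 : y * z ≈ 0#) where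

    sum : Bool × Bool × Bool → Carrier
    sum (a , b , c) = when a x + when b y + when c z

    sum-CP : ∀ s → CP (sum s)
    sum-CP (a , b , c) =
      CP-+ (CP-+ (when-CP a cx) (when-CP b cy) (when-orthogonal a b xy≈0)) (when-CP c cz) (begin
        (when a x + when b y) * when c z           ≈⟨ distribʳ (when c z) (when a x) (when b y) ⟩
        when a x * when c z + when b y * when c z  ≈⟨ +-cong (when-orthogonal a c xz≈0)
                                                             (when-orthogonal b c yz≈0) ⟩
        0# + 0#                                    ≈⟨ +-identityʳ 0# ⟩
        0#                                         ∎)

    sum-* : ∀ a b c t → sum (a , b , c) * t ≈ when a x * t + when b y * t + when c z * t
    sum-* a b c t = trans (distribʳ t _ _) (+-cong (distribʳ t _ _) refl)

    sum-*x : ∀ a b c → sum (a , b , c) * x ≈ when a x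
    sum-*x a b c = begin
      sum (a , b , c) * x                         ≈⟨ sum-* a b c x ⟩
      when a x * x + when b y * x + when c z * x  ≈⟨ +-cong (+-cong (when-idem a (CP-idem cx))
                                                                    (when-orthogonal b true yx≈0))
                                                            (when-orthogonal c true zx≈0) ⟩
      when a x + 0# + 0#                          ≈⟨ trans (+-identityʳ _) (+-identityʳ _) ⟩
      when a x                                    ∎
      where
      yx≈0 : y * x ≈ 0#
      yx≈0 = CP-orthogonal-sym cx xy≈0
      zx≈0 : z * x ≈ 0#
      zx≈0 = CP-orthogonal-sym cx xz≈0

    sum-*y : ∀ a b c → sum (a , b , c) * y ≈ when b y
    sum-*y a b c = begin
      sum (a , b , c) * y                         ≈⟨ sum-* a b c y ⟩
      when a x * y + when b y * y + when c z * y  ≈⟨ +-cong (+-cong (when-orthogonal a true xy≈0)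
                                                                    (when-idem b (CP-idem cy)))
                                                            (when-orthogonal c true zy≈0) ⟩
      0# + when b y + 0#                          ≈⟨ trans (+-identityʳ _) (+-identityˡ _) ⟩
      when b y                                    ∎
      where
      zy≈0 : z * y ≈ 0#
      zy≈0 = CP-orthogonal-sym cy yz≈0

    sum-*z : ∀ a b c → sum (a , b , c) * z ≈ when c z
    sum-*z a b c = begin
      sum (a , b , c) * z                         ≈⟨ sum-* a b c z ⟩
      when a x * z + when b y * z + when c z * z  ≈⟨ +-cong (+-cong (when-orthogonal a true xz≈0)
                                                                    (when-orthogonal b true yz≈0))
                                                            (when-idem c (CP-idem cz)) ⟩
      0# + 0# + when c z                          ≈⟨ trans (+-cong (+-identityʳ 0#) refl) (+-identityˡ _) ⟩
      when c z                                    ∎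

    sum-injective : ¬ x ≈ 0# → ¬ y ≈ 0# → ¬ z ≈ 0# → ∀ {s s′} → sum s ≈ sum s′ → s ≡ s′
    sum-injective x≉0 y≉0 z≉0 {a , b , c} {a′ , b′ , c′} eq =
      ≡.cong₂ _,_ (when-injective x≉0 (coordinate (sum-*x a b c) (sum-*x a′ b′ c′)))
        (≡.cong₂ _,_ (when-injective y≉0 (coordinate (sum-*y a b c) (sum-*y a′ b′ c′)))
                     (when-injective z≉0 (coordinate (sum-*z a b c) (sum-*z a′ b′ c′))))
      where
      coordinate : ∀ {t u u′} → sum (a , b , c) * t ≈ u → sum (a′ , b′ , c′) * t ≈ u′ → u ≈ u′
      coordinate p p′ = trans (sym p) (trans (*-cong eq refl) p′)

  orthogonal-triple⇒AtLeastCP8 : ∀ {x y z} → CP x → CP y → CP z →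
    ¬ x ≈ 0# → ¬ y ≈ 0# → ¬ z ≈ 0# → x * y ≈ 0# → x * z ≈ 0# → y * z ≈ 0# → AtLeastCP R 8
  orthogonal-triple⇒AtLeastCP8 cx cy cz x≉0 y≉0 z≉0 xy≈0 xz≈0 yz≈0 =
    (λ i → sum (bits i)) , (λ i → sum-CP (bits i)) ,
    λ i j eq → bits-injective (sum-injective x≉0 y≉0 z≉0 eq)
    where
    open OrthogonalSums cx cy cz xy≈0 xz≈0 yz≈0

  meets-both⇒AtLeastCP8 : ∀ {e q} → CP e → MeetsBoth e (e ᶜ) q → AtLeastCP R 8
  meets-both⇒AtLeastCP8 {e} {q} ce (cq , q≉1 , qe≉0 , qeᶜ≉0) =
    orthogonal-triple⇒AtLeastCP8 (CP-* cq ce) (CP-* cq (CP-ᶜ ce)) (CP-ᶜ cq)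
      qe≉0 qeᶜ≉0 (λ qᶜ≈0 → q≉1 (ᶜ≈0⇒≈1 qᶜ≈0))
      (*-orthogonalʳ (CP-central ce) (CP-*ᶜ ce) q q)
      (*-orthogonal-*ˡ (CP-central ce) (CP-*ᶜ cq))
      (*-orthogonal-*ˡ (CP-central (CP-ᶜ ce)) (CP-*ᶜ cq))

  AtLeastCP-≤ : ∀ {m n} → m ≤ n → AtLeastCP R n → AtLeastCP R m
  AtLeastCP-≤ m≤n (f , cps , injective) =
    (λ i → f (inject≤ i m≤n)) , (λ i → cps (inject≤ i m≤n)) ,
    λ i j eq → inject≤-injective m≤n m≤n i j (injective _ _ eq)

  central-*≈0⇒InRightAnn : ∀ {a h} → IsCentral R h → a * h ≈ 0# → InRightAnnOfaR R a h
  central-*≈0⇒InRightAnn {a} {h} central ah≈0 r = begin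
    a * r * h    ≈⟨ *-assoc a r h ⟩
    a * (r * h)  ≈⟨ *-cong refl (central r) ⟨
    a * (h * r)  ≈⟨ *-assoc a h r ⟨
    a * h * r    ≈⟨ *-cong ah≈0 refl ⟩
    0# * r       ≈⟨ zeroˡ r ⟩
    0#           ∎

  CP⇒IsVertex : ∀ {h} → CP h → ¬ h ≈ 0# → ¬ h ≈ 1# → IsVertex R h
  CP⇒IsVertex ch h≉0 h≉1 =
    h≉0 , _ , (λ hᶜ≈0 → h≉1 (ᶜ≈0⇒≈1 hᶜ≈0)) , central-*≈0⇒InRightAnn (CP-central (CP-ᶜ ch)) (CP-*ᶜ ch)

  CP-*≈0⇒AdjΓ : ∀ {a h} → CP h → a * h ≈ 0# → AdjΓ R a h
  CP-*≈0⇒AdjΓ ch ah≈0 r = trans (*-cong refl (CP-⋆ ch)) (central-*≈0⇒InRightAnn (CP-central ch) ah≈0 r)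

  AdjΓ-respˡ : ∀ {a a′ b} → a ≈ a′ → AdjΓ R a b → AdjΓ R a′ b
  AdjΓ-respˡ a≈a′ adj r = trans (*-cong (*-cong (sym a≈a′) refl) refl) (adj r)

  AdjΓ-respʳ : ∀ {a b b′} → b ≈ b′ → AdjΓ R a b → AdjΓ R a b′
  AdjΓ-respʳ b≈b′ adj r = trans (*-cong refl (⋆-cong (sym b≈b′))) (adj r)

  AdjΓ-sym : ∀ {a b} → AdjΓ R a b → AdjΓ R b a
  AdjΓ-sym {a} {b} adj r = begin
    b * r * a ⋆            ≈⟨ *-cong (*-cong (⋆-involutive b) (⋆-involutive r)) refl ⟨
    b ⋆ ⋆ * r ⋆ ⋆ * a ⋆    ≈⟨ *-cong (⋆-* (r ⋆) (b ⋆)) refl ⟨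
    (r ⋆ * b ⋆) ⋆ * a ⋆    ≈⟨ ⋆-* a (r ⋆ * b ⋆) ⟨
    (a * (r ⋆ * b ⋆)) ⋆    ≈⟨ ⋆-cong (*-assoc a (r ⋆) (b ⋆)) ⟨
    (a * r ⋆ * b ⋆) ⋆      ≈⟨ ⋆-cong (adj (r ⋆)) ⟩
    0# ⋆                   ≈⟨ ⋆-zero ⟩
    0#                     ∎

  AdjΓ-*ʳ : ∀ {a h} → AdjΓ R a h → ∀ x → AdjΓ R a (x * h)
  AdjΓ-*ʳ {a} {h} adj x r = begin
    a * r * (x * h) ⋆      ≈⟨ *-cong refl (⋆-* x h) ⟩
    a * r * (h ⋆ * x ⋆)    ≈⟨ *-assoc (a * r) (h ⋆) (x ⋆) ⟨
    a * r * h ⋆ * x ⋆      ≈⟨ *-cong (adj r) refl ⟩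
    0# * x ⋆               ≈⟨ zeroˡ (x ⋆) ⟩
    0#                     ∎

  AdjΓ-self⇒≈0 : ∀ {h} → IsProjection R h → AdjΓ R h h → h ≈ 0#
  AdjΓ-self⇒≈0 {h} (h²≈h , h⋆≈h) adj = begin
    h               ≈⟨ h²≈h ⟨
    h * h           ≈⟨ *-cong (*-identityʳ h) h⋆≈h ⟨
    h * 1# * h ⋆    ≈⟨ adj 1# ⟩
    0#              ∎

  sandwich⇒central : ∀ {f} → IsProjection R f → (∀ x → f * x * f ≈ x * f) → IsCentral R f
  sandwich⇒central {f} (_ , f⋆≈f) sandwich x = begin
    f * x                ≈⟨ *-cong refl (⋆-involutive x) ⟨
    f * x ⋆ ⋆            ≈⟨ ⋆-*-selfAdjointʳ f⋆≈f (x ⋆) ⟨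
    (x ⋆ * f) ⋆          ≈⟨ ⋆-cong (sandwich (x ⋆)) ⟨
    (f * x ⋆ * f) ⋆      ≈⟨ ⋆-*-selfAdjointʳ f⋆≈f (f * x ⋆) ⟩
    f * (f * x ⋆) ⋆      ≈⟨ *-cong refl (⋆-*-selfAdjointˡ f⋆≈f (x ⋆)) ⟩
    f * (x ⋆ ⋆ * f)      ≈⟨ *-cong refl (*-cong (⋆-involutive x) refl) ⟩
    f * (x * f)          ≈⟨ *-assoc f x f ⟨
    f * x * f            ≈⟨ sandwich x ⟩
    x * f                ∎

  module _ (pqb : IsPQBaer R) where

    annihilator : Carrier → Carrier
    annihilator a = proj₁ (pqb a)

    annihilator-projection : ∀ a → IsProjection R (annihilator a)
    annihilator-projection a = proj₁ (proj₂ (pqb a))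

    annihilator-generates : ∀ a x → InRightAnnOfaR R a x ⇔ InPrincipalRight R (annihilator a) x
    annihilator-generates a = proj₂ (proj₂ (pqb a))

    annihilator-annihilates : ∀ a → InRightAnnOfaR R a (annihilator a)
    annihilator-annihilates a = Equivalence.from (annihilator-generates a (annihilator a))
      (annihilator a , sym (proj₁ (annihilator-projection a)))

    annihilator-absorbs : ∀ {a x} → InRightAnnOfaR R a x → annihilator a * x ≈ x
    annihilator-absorbs {a} {x} x∈r[aR] with Equivalence.to (annihilator-generates a x) x∈r[aR]
    ... | y , x≈fy = begin
      f * x        ≈⟨ *-cong refl x≈fy ⟩
      f * (f * y)  ≈⟨ *-assoc f f y ⟨
      f * f * y    ≈⟨ *-cong (proj₁ (annihilator-projection a)) refl ⟩
      f * y        ≈⟨ x≈fy ⟨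
      x            ∎
      where
      f : Carrier
      f = annihilator a

    annihilator-CP : ∀ a → CP (annihilator a)
    annihilator-CP a = annihilator-projection a , sandwich⇒central (annihilator-projection a) sandwich
      where
      f : Carrier
      f = annihilator a
      sandwich : ∀ x → f * x * f ≈ x * f
      sandwich x = trans (*-assoc f x f) (annihilator-absorbs λ r → begin
        a * r * (x * f)  ≈⟨ *-assoc (a * r) x f ⟨
        a * r * x * f    ≈⟨ *-cong (*-assoc a r x) refl ⟩
        a * (r * x) * f  ≈⟨ annihilator-annihilates a (r * x) ⟩
        0#               ∎)

    support : Carrier → Carrier
    support a = annihilator a ᶜ

    support-CP : ∀ a → CP (support a)
    support-CP a = CP-ᶜ (annihilator-CP a)

    *-support : ∀ a → a * support a ≈ a
    *-support a = begin
      a * f ᶜ    ≈⟨ ᶜ-*ʳ f a ⟩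
      a - a * f  ≈⟨ +-cong refl (-‿cong af≈0) ⟩
      a - 0#     ≈⟨ x-0≈x a ⟩
      a          ∎
      where
      f : Carrier
      f = annihilator a
      af≈0 : a * f ≈ 0#
      af≈0 = trans (*-cong (sym (*-identityʳ a)) refl) (annihilator-annihilates a 1#)

    support-annihilates : ∀ {a x} → InRightAnnOfaR R a x → support a * x ≈ 0#
    support-annihilates {a} {x} x∈r[aR] =
      trans (ᶜ-*ˡ (annihilator a) x) (x≈y⇒x∙y⁻¹≈ε (sym (annihilator-absorbs x∈r[aR])))

    support*≈0⇒*≈0 : ∀ {a x} → support a * x ≈ 0# → a * x ≈ 0#
    support*≈0⇒*≈0 {a} {x} sx≈0 = begin
      a * x                ≈⟨ *-cong (*-support a) refl ⟨
      a * support a * x    ≈⟨ *-assoc a (support a) x ⟩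
      a * (support a * x)  ≈⟨ *-cong refl sx≈0 ⟩
      a * 0#               ≈⟨ zeroʳ a ⟩
      0#                   ∎

    support≉0 : ∀ {a} → ¬ a ≈ 0# → ¬ support a ≈ 0#
    support≉0 {a} a≉0 s≈0 = a≉0 (begin
      a              ≈⟨ *-support a ⟨
      a * support a  ≈⟨ *-cong refl s≈0 ⟩
      a * 0#         ≈⟨ zeroʳ a ⟩
      0#             ∎)

    support≉1 : ∀ {a} → IsVertex R a → ¬ support a ≈ 1#
    support≉1 {a} (_ , x , x≉0 , x∈r[aR]) s≈1 = x≉0 (begin
      x                  ≈⟨ annihilator-absorbs x∈r[aR] ⟨
      annihilator a * x  ≈⟨ *-cong (ᶜ≈1⇒≈0 s≈1) refl ⟩
      0# * x             ≈⟨ zeroˡ x ⟩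
      0#                 ∎)

    AdjΓ⇒*support≈0 : ∀ {a h} → CP h → AdjΓ R a h → h * support a ≈ 0#
    AdjΓ⇒*support≈0 ch adj =
      trans (CP-central ch _) (support-annihilates λ r → trans (*-cong refl (sym (CP-⋆ ch))) (adj r))

    AdjΓ⇒supports-orthogonal : ∀ {a b} → AdjΓ R a b → support a * support b ≈ 0#
    AdjΓ⇒supports-orthogonal {a} {b} adj =
      AdjΓ⇒*support≈0 (support-CP a) (CP-*≈0⇒AdjΓ (support-CP a) b·sa≈0)
      where
      b·sa≈0 : b * support a ≈ 0#
      b·sa≈0 = begin
        b * support a            ≈⟨ *-cong (⋆-involutive b) refl ⟨
        b ⋆ ⋆ * support a        ≈⟨ ⋆-*-selfAdjointˡ (CP-⋆ (support-CP a)) (b ⋆) ⟨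
        (support a * b ⋆) ⋆      ≈⟨ ⋆-cong (support-annihilates adj) ⟩
        0# ⋆                     ≈⟨ ⋆-zero ⟩
        0#                       ∎

    leaving-edge⇒AtLeastCP8 : ∀ {e} (u w : Vertex R) → CP e → AdjComplement R u w →
      AdjΓ R (proj₁ u) (e ᶜ) → ¬ AdjΓ R (proj₁ w) (e ᶜ) → AtLeastCP R 8
    leaving-edge⇒AtLeastCP8 {e} (u , _) (w , w-vertex) ce (_ , ¬adj-uw) adj-ueᶜ ¬adj-weᶜ =
      meets-both⇒AtLeastCP8 ce (support-CP w , support≉1 w-vertex , qe≉0 , qeᶜ≉0)
      where
      q : Carrier
      q = support w
      qeᶜ≉0 : ¬ q * e ᶜ ≈ 0#
      qeᶜ≉0 qeᶜ≈0 = ¬adj-weᶜ (CP-*≈0⇒AdjΓ (CP-ᶜ ce) (support*≈0⇒*≈0 qeᶜ≈0))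
      qe≉0 : ¬ q * e ≈ 0#
      qe≉0 qe≈0 = ¬adj-uw (AdjΓ-respʳ w·eᶜ≈w (AdjΓ-*ʳ adj-ueᶜ w))
        where
        w·eᶜ≈w : w * e ᶜ ≈ w
        w·eᶜ≈w = begin
          w * e ᶜ             ≈⟨ +-identityˡ (w * e ᶜ) ⟨
          0# + w * e ᶜ        ≈⟨ +-cong (support*≈0⇒*≈0 qe≈0) refl ⟨
          w * e + w * e ᶜ     ≈⟨ *-split w e ⟩
          w                   ∎

    module _ (em : ExcludedMiddle (c ⊔ ℓ)) where

      decide : (A : Set ℓ) → Dec A
      decide A = map′ lower lift (em {Lift c A})

      avoiding : ∀ {m n} → m < n → AtLeastCP R n → (forbidden : Fin m → Carrier) →
        ∃ λ e → CP e × ∀ k → ¬ e ≈ forbidden k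
      avoiding {m} {n} m<n (f , cps , injective) forbidden
        with decide (Σ (Fin n) λ i → ∀ k → ¬ f i ≈ forbidden k)
      ... | yes (i , avoids) = f i , cps i , avoids
      ... | no ¬avoids =
        let i , j , i<j , same = pigeonhole m<n (λ i → proj₁ (hit i))
            fi≈fj = trans (proj₂ (hit i)) (trans (reflexive (≡.cong forbidden same)) (sym (proj₂ (hit j))))
        in contradiction (injective i j fi≈fj) (<⇒≢ i<j)
        where
        hit : ∀ i → Σ (Fin m) λ k → f i ≈ forbidden k
        hit i with decide (Σ (Fin m) λ k → f i ≈ forbidden k)
        ... | yes found = found
        ... | no ¬found = contradiction (i , λ k fi≈ → ¬found (k , fi≈)) ¬avoids

      crossing-edge : (Q : Carrier → Set (c ⊔ ℓ)) → (∀ {x y} → x ≈ y → Q x → Q y) →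
        ∀ {s t} → WalkComplement R s t → Q (proj₁ s) → ¬ Q (proj₁ t) →
        ∃₂ λ u w → AdjComplement R u w × Q (proj₁ u) × ¬ Q (proj₁ w)
      crossing-edge Q resp (stop s≈t) Qs ¬Qt = contradiction (resp s≈t Qs) ¬Qt
      crossing-edge Q resp (step {u} {w} uw walk) Qu ¬Qt with em {Q (proj₁ w)}
      ... | yes Qw = crossing-edge Q resp walk Qw ¬Qt
      ... | no ¬Qw = u , w , uw , Qu , ¬Qw

      connected⇒AtLeastCP8 : ∀ {e} → CP e → ¬ e ≈ 0# → ¬ e ≈ 1# →
        ComplementConnected R → AtLeastCP R 8
      connected⇒AtLeastCP8 {e} ce e≉0 e≉1 connected
        with crossing-edge (λ x → AdjΓ R x (e ᶜ)) AdjΓ-respˡ (connected e-vertex eᶜ-vertex)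
               (CP-*≈0⇒AdjΓ (CP-ᶜ ce) (CP-*ᶜ ce)) (λ adj → eᶜ≉0 (AdjΓ-self⇒≈0 (proj₁ (CP-ᶜ ce)) adj))
        where
        eᶜ≉0 : ¬ e ᶜ ≈ 0#
        eᶜ≉0 eᶜ≈0 = e≉1 (ᶜ≈0⇒≈1 eᶜ≈0)
        e-vertex : Vertex R
        e-vertex = e , CP⇒IsVertex ce e≉0 e≉1
        eᶜ-vertex : Vertex R
        eᶜ-vertex = e ᶜ , CP⇒IsVertex (CP-ᶜ ce) eᶜ≉0 (λ eᶜ≈1 → e≉0 (ᶜ≈1⇒≈0 eᶜ≈1))
      ... | u , w , uw , adj-ueᶜ , ¬adj-weᶜ = leaving-edge⇒AtLeastCP8 u w ce uw adj-ueᶜ ¬adj-weᶜ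

      connected⇒AtLeastCP6 : AtLeastCP R 4 → ComplementConnected R → AtLeastCP R 6
      connected⇒AtLeastCP6 four connected =
        let e , ce , e∉ = avoiding (s<s (s<s z<s)) four (0# ∷ 1# ∷ [])
        in AtLeastCP-≤ (m≤m+n 6 2) (connected⇒AtLeastCP8 ce (e∉ 0F) (e∉ 1F) connected)

      fifth-CP⇒meets-both : ∀ {p q z} → CP p → CP q → CP z → p + q ≈ 1# → ¬ p ≈ 0# → ¬ q ≈ 0# →
        (∀ k → ¬ z ≈ (0# ∷ 1# ∷ p ∷ q ∷ []) k) → ∃ (MeetsBoth p q)
      fifth-CP⇒meets-both {p} {q} {z} cp cq cz p+q≈1 p≉0 q≉0 z∉
        with decide (z * p ≈ 0#) | decide (z * q ≈ 0#)
      ... | yes zp≈0 | _ = z ᶜ , complement-meets-both cz (z∉ 0F) (z∉ 3F) p≉0 p+q≈1 zp≈0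
      ... | no _ | yes zq≈0 =
        z ᶜ , MeetsBoth-swap (complement-meets-both cz (z∉ 0F) (z∉ 2F) q≉0 (trans (+-comm q p) p+q≈1) zq≈0)
      ... | no zp≉0 | no zq≉0 = z , cz , z∉ 1F , zp≉0 , zq≉0

      orthogonal⇒meets-both : AtLeastCP R 6 → ∀ {p q} → CP p → CP q → ¬ p ≈ 0# → ¬ q ≈ 0# →
        p * q ≈ 0# → ∃ (MeetsBoth p q)
      orthogonal⇒meets-both six {p} {q} cp cq p≉0 q≉0 pq≈0 with decide (p + q ≈ 1#)
      ... | no p+q≉1 =
        p + q , CP-+ cp cq pq≈0 , p+q≉1 , (λ eq → p≉0 (trans (sym [p+q]p≈p) eq)) ,
        λ eq → q≉0 (trans (sym [p+q]q≈q) eq)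
        where
        [p+q]p≈p : (p + q) * p ≈ p
        [p+q]p≈p = trans (distribʳ p p q)
          (trans (+-cong (CP-idem cp) (CP-orthogonal-sym cp pq≈0)) (+-identityʳ p))
        [p+q]q≈q : (p + q) * q ≈ q
        [p+q]q≈q = trans (distribʳ q p q) (trans (+-cong pq≈0 (CP-idem cq)) (+-identityˡ q))
      ... | yes p+q≈1 =
        let z , cz , z∉ = avoiding (s<s (s<s (s<s (s<s z<s)))) six (0# ∷ 1# ∷ p ∷ q ∷ [])
        in fifth-CP⇒meets-both cp cq cz p+q≈1 p≉0 q≉0 z∉

      non-adjacent⇒walk : ∀ u v → ¬ AdjΓ R (proj₁ u) (proj₁ v) → WalkComplement R u v
      non-adjacent⇒walk u v ¬adj with decide (proj₁ u ≈ proj₁ v)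
      ... | yes u≈v = stop u≈v
      ... | no u≉v = step {w = v} (u≉v , ¬adj) (stop refl)

      adjacent⇒walk : AtLeastCP R 6 → ∀ u v → AdjΓ R (proj₁ u) (proj₁ v) → WalkComplement R u v
      adjacent⇒walk six (a , a≉0 , _) v@(b , b≉0 , _) adj
        with orthogonal⇒meets-both six (support-CP a) (support-CP b) (support≉0 a≉0) (support≉0 b≉0)
               (AdjΓ⇒supports-orthogonal adj)
      ... | h , ch , h≉1 , h·sa≉0 , h·sb≉0 =
        step {w = h-vertex} (a≉h , ¬adj-ah) (non-adjacent⇒walk h-vertex v ¬adj-hb)
        where
        h-vertex : Vertex R
        h-vertex = h , CP⇒IsVertex ch (λ h≈0 → h·sa≉0 (trans (*-cong h≈0 refl) (zeroˡ _))) h≉1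
        ¬adj-ah : ¬ AdjΓ R a h
        ¬adj-ah adj-ah = h·sa≉0 (AdjΓ⇒*support≈0 ch adj-ah)
        ¬adj-hb : ¬ AdjΓ R h b
        ¬adj-hb adj-hb = h·sb≉0 (AdjΓ⇒*support≈0 ch (AdjΓ-sym adj-hb))
        a≉h : ¬ a ≈ h
        a≉h a≈h = ¬adj-hb (AdjΓ-respˡ a≈h adj)

      AtLeastCP6⇒connected : AtLeastCP R 6 → ComplementConnected R
      AtLeastCP6⇒connected six u v with em {AdjΓ R (proj₁ u) (proj₁ v)}
      ... | yes adj = adjacent⇒walk six u v adj
      ... | no ¬adj = non-adjacent⇒walk u v ¬adj

theorem4p7 : ∀ {c ℓ} → ExcludedMiddle (c ⊔ ℓ) → (R : StarRing c ℓ) → IsPQBaer R → AtLeastCP R 4 →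
    (ComplementConnected R ⇔ AtLeastCP R 6)
theorem4p7 em R pqb four = mk⇔ (connected⇒AtLeastCP6 R pqb em four) (AtLeastCP6⇒connected R pqb em)
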